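{- Let $K$ be a triangulated polyhedral map with $n$ vertices and let $M$ be its dual map. Let $T$ be a tree in $EG(M)$ satisfying: (1) whenever two vertices $u_1,u_2$ of $T$ lie on a face $F$ of $M$, a path joining $u_1$ and $u_2$ in the boundary of $F$ is a subtree of $T$; (2) any path in $T$ which lies in a face $F$ of $M$ has length at most $q-2$, where $q$ is the length of the boundary of $F$; (3) $T$ touches all the faces of $M$ (every face of $M$ contains a vertex of $T$). Then $T$ has exactly $n-2$ vertices.
   Context: A map on a surface is an embedding of a finite simple graph in a connected closed surface such that the closure of each complementary component is a $p$-gonal 2-disc ($p\ge3$), the faces; it is polyhedral if any two faces meet in the empty set, a vertex or an edge, and triangulated if every face is a triangle. $EG(\cdot)$ is the edge graph. The dual map $M$ of $K$ has one vertex per face of $K$ and, for each edge of $K$, an edge joining the vertices of the two faces containing it; faces of $M$ correspond to vertices of $K$. -}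

module Defs where

open import Data.Nat using (ℕ; _≤_; _∸_; _≥_)
open import Data.Fin using (Fin)
open import Data.Fin.Subset using (Subset; _∈_; _∩_; ∣_∣)
open import Data.Vec using (tabulate; lookup)
open import Data.List using (List; []; _∷_; _++_; [_]; length; head; last)
open import Data.List.Relation.Unary.All using (All)
open import Data.List.Relation.Unary.Linked using (Linked)
open import Data.List.Relation.Unary.Unique.Propositional using (Unique)
open import Data.Maybe using (just)
open import Data.Product using (Σ; ∃; _×_)
open import Data.Sum using (_⊎_)
open import Relation.Binary.PropositionalEquality using (_≡_; _≢_)
open import Function using (Injective)
open import Relation.Nullary using (¬_)

IsPath : ∀ {A : Set} → (A → A → Set) → A → A → List A → Set
IsPath R u w xs = Linked R xs × Unique xs × head xs ≡ just u × last xs ≡ just w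

pathLength : ∀ {A : Set} → List A → ℕ
pathLength xs = length xs ∸ 1

-- a cycle x, xs..., y, (back to x) of length ≥ 3 with distinct vertices
HasCycle : ∀ {A : Set} → (A → A → Set) → Set
HasCycle {A} R = Σ A λ x → Σ A λ y → Σ (List A) λ xs →
  length xs ≥ 1 × Linked R (x ∷ xs ++ [ y ]) × Unique (x ∷ xs ++ [ y ]) × R y x

-- Triangulated polyhedral maps, combinatorially:
-- vertices Fin n, faces = m triangles, each a 3-element vertex set.

Triangles : ℕ → ℕ → Set
Triangles n m = Fin m → Subset n

module _ {n m : ℕ} (tri : Triangles n m) where

  KEdge : Fin n → Fin n → Set
  KEdge a b = a ≢ b × ∃ λ i → a ∈ tri i × b ∈ tri i

  LinkEdge : Fin n → Fin n → Fin n → Set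
  LinkEdge v a b = a ≢ b × a ≢ v × b ≢ v × ∃ λ i → v ∈ tri i × a ∈ tri i × b ∈ tri i

  record IsTriangulatedPolyhedralMap : Set where
    field
      triangle   : ∀ i → ∣ tri i ∣ ≡ 3
      -- polyhedral: distinct faces have distinct vertex sets
      -- (so two triangles meet in ∅, a vertex or an edge)
      polyhedral : Injective _≡_ _≡_ tri
      covered    : ∀ v → ∃ λ i → v ∈ tri i
      edgeTwo    : ∀ i a b → a ≢ b → a ∈ tri i → b ∈ tri i →
                   ∃ λ j → j ≢ i × a ∈ tri j × b ∈ tri j ×
                     (∀ k → a ∈ tri k → b ∈ tri k → k ≡ i ⊎ k ≡ j)
      -- vertex links are connected (so each link is a single cycle:
      -- the surface is a closed 2-manifold, not a pseudo-manifold)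
      linkConn   : ∀ v a b → KEdge v a → KEdge v b →
                   ∃ λ xs → IsPath (LinkEdge v) a b xs
      connected  : ∀ a b → ∃ λ xs → IsPath KEdge a b xs

  -- The dual map M: vertices = triangles, edges = pairs of triangles
  -- sharing an edge, face F_v = triangles containing v (its boundary
  -- cycle is the subgraph of EG(M) induced on these triangles).

  DualAdj : Fin m → Fin m → Set
  DualAdj i j = i ≢ j × ∣ tri i ∩ tri j ∣ ≡ 2

  OnFace : Fin n → Fin m → Set
  OnFace v i = v ∈ tri i

  faceLength : Fin n → ℕ
  faceLength v = ∣ tabulate (λ i → lookup (tri i) v) ∣

  record IsTreeInDual (S : Subset m) (E : Fin m → Fin m → Set) : Set where
    field
      edgeInEG  : ∀ i j → E i j → DualAdj i j
      edgeSym   : ∀ i j → E i j → E j i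
      edgeVerts : ∀ i j → E i j → i ∈ S × j ∈ S
      nonempty  : ∃ λ i → i ∈ S
      conn      : ∀ i j → i ∈ S → j ∈ S →
                  ∃ λ xs → IsPath E i j xs
      acyclic   : ¬ HasCycle E

-- For a vertex v of K let d(v) be the number of vertices of T lying on the face F_v of M,
-- i.e. the number of triangles of T containing v. By (1) the triangles of T containing v
-- span a subtree, so removing a leaf ℓ of T with neighbour p lowers Σ_v (d(v) ∸ 1) by
-- exactly |ℓ ∩ p| = 2: each shared vertex loses one triangle but keeps p, and the third
-- vertex of ℓ lies on no other triangle of T. Hence Σ_v (d(v) ∸ 1) = 2|T| − 2. Counting
-- incidences gives Σ_v d(v) = 3|T|, and by (3) every d(v) ≥ 1, so 3|T| = 2|T| − 2 + n.

module Submission where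

open import Defs

open import Data.Bool.Base using (true; false; if_then_else_; _∧_)
open import Data.Fin.Base using (Fin; zero; suc; punchIn)
open import Data.Fin.Properties as Fin using (punchInᵢ≢i; pigeonhole; any?; _≟_)
open import Data.Fin.Subset using (Subset; _∈_; _∉_; _∩_; _─_; _-_; ⁅_⁆; ∣_∣; inside; outside; Nonempty)
open import Data.Fin.Subset.Properties
  using (_∈?_; p─q⊆p; x∈p∧x≢y⇒x∈p-y; x∉⁅y⁆⇒x≢y; nonempty?; Empty-unique; ∣⊥∣≡0)
open import Data.List.Base using (List; []; _∷_; _++_; [_]; length; last; lookup)
open import Data.List.Membership.Propositional using () renaming (_∈_ to _∈ₗ_)
open import Data.List.Membership.Propositional.Properties using (∈-lookup; ∈-∃++)
open import Data.List.Relation.Unary.All as All using (All; []; _∷_)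
open import Data.List.Relation.Unary.All.Properties using (++⁺; ++⁻ˡ; ++⁻ʳ; ¬Any⇒All¬)
open import Data.List.Relation.Unary.AllPairs using ([]; _∷_)
open import Data.List.Relation.Unary.Any using (here; there)
open import Data.List.Relation.Unary.Linked as Linked using (Linked; []; [-]; _∷_)
open import Data.List.Relation.Unary.Unique.Propositional using (Unique)
open import Data.List.Relation.Unary.Unique.Propositional.Properties using (Unique[x∷xs]⇒x∉xs)
open import Data.Maybe.Base using (just)
open import Data.Nat.Base using (ℕ; zero; suc; _+_; _*_; _∸_; _≤_; _<_; z≤n; s≤s; s≤s⁻¹)
open import Data.Nat.Properties as ℕ hiding (_≟_)
open import Algebra.Properties.Monoid.Sum +-0-monoid using (sum-syntax; sum-cong-≗)
open import Algebra.Properties.CommutativeMonoid.Sum +-0-commutativeMonoid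
  using (sum-remove; ∑-distrib-+; ∑-comm)
open import Data.Product.Base using (∃; ∃₂; _×_; _,_; proj₁; proj₂)
open import Data.Vec.Base using ([]; _∷_; here; there) renaming (lookup to lookupᵥ)
open import Data.Vec.Properties using ([]=⇒lookup; lookup⇒[]=; lookup-zipWith)
open import Function.Base using (_∘_)
open import Relation.Binary.PropositionalEquality
  using (_≡_; _≢_; refl; sym; trans; cong; cong₂; subst; module ≡-Reasoning)
open import Relation.Nullary.Decidable using (Dec; yes; no; _×-dec_; ¬?; decidable-stable; ¬¬-excluded-middle)
open import Relation.Nullary.Negation using (¬_; contradiction; ¬¬-map)

∑-*ˡ : ∀ {k} c (f : Fin k → ℕ) → ∑[ i < k ] (c * f i) ≡ c * ∑[ i < k ] f i
∑-*ˡ {zero}  c f = sym (*-zeroʳ c)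
∑-*ˡ {suc k} c f = trans (cong (c * f zero +_) (∑-*ˡ c (f ∘ suc)))
                         (sym (*-distribˡ-+ c (f zero) _))

∑-const : ∀ k c → ∑[ i < k ] c ≡ k * c
∑-const zero    c = refl
∑-const (suc k) c = cong (c +_) (∑-const k c)

∑-mono-≤ : ∀ {k} {f g : Fin k → ℕ} → (∀ i → f i ≤ g i) → ∑[ i < k ] f i ≤ ∑[ i < k ] g i
∑-mono-≤ {zero}  f≤g = z≤n
∑-mono-≤ {suc k} f≤g = +-mono-≤ (f≤g zero) (∑-mono-≤ (f≤g ∘ suc))

term≤∑ : ∀ {k} (f : Fin k → ℕ) i → f i ≤ ∑[ j < k ] f j
term≤∑ f zero    = m≤m+n _ _
term≤∑ f (suc i) = ≤-trans (term≤∑ (f ∘ suc) i) (m≤n+m _ _)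

∑-pred : ∀ {k} (f : Fin k → ℕ) → (∀ i → 1 ≤ f i) → ∑[ i < k ] f i ≡ ∑[ i < k ] (f i ∸ 1) + k
∑-pred {k} f 1≤f = begin
  ∑[ i < k ] f i                      ≡⟨ sum-cong-≗ (λ i → sym (m∸n+n≡m (1≤f i))) ⟩
  ∑[ i < k ] (f i ∸ 1 + 1)            ≡⟨ ∑-distrib-+ (λ i → f i ∸ 1) (λ _ → 1) ⟩
  ∑[ i < k ] (f i ∸ 1) + ∑[ i < k ] 1 ≡⟨ cong (∑[ i < k ] (f i ∸ 1) +_) (trans (∑-const k 1) (*-identityʳ k)) ⟩
  ∑[ i < k ] (f i ∸ 1) + k            ∎
  where open ≡-Reasoning

χ : ∀ {n} → Subset n → Fin n → ℕ
χ p i = if lookupᵥ p i then 1 else 0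

χ-∈ : ∀ {n} {p : Subset n} {i} → i ∈ p → χ p i ≡ 1
χ-∈ i∈p rewrite []=⇒lookup i∈p = refl

χ-∉ : ∀ {n} {p : Subset n} {i} → i ∉ p → χ p i ≡ 0
χ-∉ {p = p} {i} i∉p with lookupᵥ p i in eq
... | true  = contradiction (lookup⇒[]= i p eq) i∉p
... | false = refl

χ≤1 : ∀ {n} (p : Subset n) i → χ p i ≤ 1
χ≤1 p i with lookupᵥ p i
... | true  = ≤-refl
... | false = z≤n

χ-∩ : ∀ {n} (p q : Subset n) i → χ (p ∩ q) i ≡ χ p i * χ q i
χ-∩ p q i rewrite lookup-zipWith _∧_ i p q with lookupᵥ p i | lookupᵥ q i
... | true  | true  = refl
... | true  | false = refl
... | false | _     = refl

∣p∣≡∑χ : ∀ {n} (p : Subset n) → ∣ p ∣ ≡ ∑[ i < n ] χ p i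
∣p∣≡∑χ []            = refl
∣p∣≡∑χ (inside ∷ p)  = cong suc (∣p∣≡∑χ p)
∣p∣≡∑χ (outside ∷ p) = ∣p∣≡∑χ p

∣p∩q∣≡∑χχ : ∀ {n} (p q : Subset n) → ∣ p ∩ q ∣ ≡ ∑[ i < n ] (χ p i * χ q i)
∣p∩q∣≡∑χχ p q = trans (∣p∣≡∑χ (p ∩ q)) (sum-cong-≗ (χ-∩ p q))

x∈p─q⇒x∉q : ∀ {n} {p q : Subset n} {x} → x ∈ p ─ q → x ∉ q
x∈p─q⇒x∉q {p = _ ∷ _} ()        here
x∈p─q⇒x∉q {p = _ ∷ _} (there x∈) (there x∈q) = x∈p─q⇒x∉q x∈ x∈q

x∈p-y⇒x∈p×x≢y : ∀ {n} {p : Subset n} {x y} → x ∈ p - y → x ∈ p × x ≢ y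
x∈p-y⇒x∈p×x≢y {p = p} {y = y} x∈ = p─q⊆p p ⁅ y ⁆ x∈ , x∉⁅y⁆⇒x≢y (x∈p─q⇒x∉q {p = p} x∈)

χ-remove-self : ∀ {n} (p : Subset n) x → χ (p - x) x ≡ 0
χ-remove-self p x = χ-∉ {p = p - x} (λ x∈p-x → proj₂ (x∈p-y⇒x∈p×x≢y {p = p} x∈p-x) refl)

χ-remove-other : ∀ {n} (p : Subset n) {x y} → y ≢ x → χ (p - x) y ≡ χ p y
χ-remove-other p {x} {y} y≢x with y ∈? p
... | yes y∈p = trans (χ-∈ (x∈p∧x≢y⇒x∈p-y y∈p y≢x)) (sym (χ-∈ y∈p))
... | no  y∉p = trans (χ-∉ (y∉p ∘ p─q⊆p p ⁅ x ⁆)) (sym (χ-∉ y∉p))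

1≤∣p∣⇒Nonempty : ∀ {n} (p : Subset n) → 1 ≤ ∣ p ∣ → Nonempty p
1≤∣p∣⇒Nonempty {n} p 1≤∣p∣ with nonempty? p
... | yes ne = ne
... | no  ¬ne = contradiction (trans (cong ∣_∣ (Empty-unique ¬ne)) (∣⊥∣≡0 n)) (>⇒≢ 1≤∣p∣)

infixl 10 ∑∈
∑∈ : ∀ {m} → Subset m → (Fin m → ℕ) → ℕ
∑∈ {m} S w = ∑[ i < m ] (χ S i * w i)
syntax ∑∈ S (λ i → w) = ∑[ i ∈ S ] w

∑∈-const : ∀ {m} (S : Subset m) c → ∑[ i ∈ S ] c ≡ c * ∣ S ∣
∑∈-const {m} S c = begin
  ∑[ i < m ] (χ S i * c)   ≡⟨ sum-cong-≗ (λ i → *-comm (χ S i) c) ⟩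
  ∑[ i < m ] (c * χ S i)   ≡⟨ ∑-*ˡ c (χ S) ⟩
  c * ∑[ i < m ] χ S i     ≡⟨ cong (c *_) (∣p∣≡∑χ S) ⟨
  c * ∣ S ∣                ∎
  where open ≡-Reasoning

∑∈-zero : ∀ {m} (S : Subset m) (w : Fin m → ℕ) → (∀ {i} → i ∈ S → w i ≡ 0) → ∑[ i ∈ S ] w i ≡ 0
∑∈-zero {m} S w w≡0 = trans (sum-cong-≗ term≡0) (trans (∑-const m 0) (*-zeroʳ m))
  where
  term≡0 : ∀ i → χ S i * w i ≡ 0
  term≡0 i with i ∈? S
  ... | yes i∈S = trans (cong (χ S i *_) (w≡0 i∈S)) (*-zeroʳ (χ S i))
  ... | no  i∉S = cong (_* w i) (χ-∉ i∉S)

∑∈-≥ : ∀ {m} {S : Subset m} (w : Fin m → ℕ) {i} → i ∈ S → w i ≤ ∑[ j ∈ S ] w j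
∑∈-≥ {S = S} w {i} i∈S =
  subst (_≤ ∑[ j ∈ S ] w j) (trans (cong (_* w i) (χ-∈ i∈S)) (*-identityˡ (w i)))
        (term≤∑ (λ j → χ S j * w j) i)

∑∈-remove : ∀ {m} {S : Subset m} (w : Fin m → ℕ) {ℓ} → ℓ ∈ S →
            ∑[ i ∈ S ] w i ≡ w ℓ + ∑[ i ∈ S - ℓ ] w i
∑∈-remove {suc m} {S} w {ℓ} ℓ∈S = begin
  ∑[ i ∈ S ] w i                           ≡⟨ sum-remove {i = ℓ} (λ i → χ S i * w i) ⟩
  χ S ℓ * w ℓ + ∑[ j < m ] rest S j        ≡⟨ cong₂ _+_ (trans (cong (_* w ℓ) (χ-∈ ℓ∈S)) (*-identityˡ (w ℓ)))
                                                       (sum-cong-≗ rest-unchanged) ⟩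
  w ℓ + ∑[ j < m ] rest (S - ℓ) j          ≡⟨ cong (λ c → w ℓ + (c * w ℓ + ∑[ j < m ] rest (S - ℓ) j))
                                                   (χ-remove-self S ℓ) ⟨
  w ℓ + (χ (S - ℓ) ℓ * w ℓ + ∑[ j < m ] rest (S - ℓ) j)
                                           ≡⟨ cong (w ℓ +_) (sum-remove {i = ℓ} (λ i → χ (S - ℓ) i * w i)) ⟨
  w ℓ + ∑[ i ∈ S - ℓ ] w i                 ∎
  where
  open ≡-Reasoning
  rest : Subset (suc m) → Fin m → ℕ
  rest T j = χ T (punchIn ℓ j) * w (punchIn ℓ j)
  rest-unchanged : ∀ j → rest S j ≡ rest (S - ℓ) j
  rest-unchanged j = cong (_* w (punchIn ℓ j)) (sym (χ-remove-other S (punchInᵢ≢i ℓ j)))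

∣p∣≡1+∣p-x∣ : ∀ {m} {p : Subset m} {x} → x ∈ p → ∣ p ∣ ≡ suc ∣ p - x ∣
∣p∣≡1+∣p-x∣ {p = p} {x} x∈p = begin
  ∣ p ∣               ≡⟨ trans (sym (*-identityˡ ∣ p ∣)) (sym (∑∈-const p 1)) ⟩
  ∑[ i ∈ p ] 1        ≡⟨ ∑∈-remove (λ _ → 1) x∈p ⟩
  suc (∑[ i ∈ p - x ] 1) ≡⟨ cong suc (trans (∑∈-const (p - x) 1) (*-identityˡ _)) ⟩
  suc ∣ p - x ∣       ∎
  where open ≡-Reasoning

Unique⇒lookup-injective : ∀ {A : Set} {xs : List A} → Unique xs →
                          ∀ i j → lookup xs i ≡ lookup xs j → i ≡ j
Unique⇒lookup-injective (_ ∷ _)     zero    zero    _ = refl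
Unique⇒lookup-injective u@(_ ∷ _)   zero    (suc j) e =
  contradiction (subst (_∈ₗ _) (sym e) (∈-lookup j)) (Unique[x∷xs]⇒x∉xs u)
Unique⇒lookup-injective u@(_ ∷ _)   (suc i) zero    e =
  contradiction (subst (_∈ₗ _) e (∈-lookup i)) (Unique[x∷xs]⇒x∉xs u)
Unique⇒lookup-injective (_ ∷ u)     (suc i) (suc j) e = cong suc (Unique⇒lookup-injective u i j e)

Unique⇒length≤ : ∀ {m} {xs : List (Fin m)} → Unique xs → length xs ≤ m
Unique⇒length≤ {m} {xs} u with length xs ≤? m
... | yes ≤m = ≤m
... | no  ≰m with pigeonhole (≰⇒> ≰m) (lookup xs)
... | i , j , i<j , e = contradiction (Unique⇒lookup-injective u i j e) (Fin.<⇒≢ i<j)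

module _ {A : Set} where

  Linked-restrict : ∀ {R : A → A → Set} {P : A → Set} {xs} → Linked R xs → All P xs →
                    Linked (λ a b → R a b × P a × P b) xs
  Linked-restrict []       _               = []
  Linked-restrict [-]      _               = [-]
  Linked-restrict (r ∷ rs) (pa ∷ pb ∷ pxs) = (r , pa , pb) ∷ Linked-restrict rs (pb ∷ pxs)

  Linked-prefix : ∀ {R : A → A → Set} xs {y zs} → Linked R (xs ++ y ∷ zs) → Linked R (xs ++ [ y ])
  Linked-prefix []            _        = [-]
  Linked-prefix (x ∷ [])      (r ∷ _)  = r ∷ [-]
  Linked-prefix (x ∷ x′ ∷ xs) (r ∷ rs) = r ∷ Linked-prefix (x′ ∷ xs) rs

  Unique-prefix : ∀ xs {y : A} {zs} → Unique (xs ++ y ∷ zs) → Unique (xs ++ [ y ])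
  Unique-prefix []       _          = [] ∷ []
  Unique-prefix (x ∷ xs) (x∉ ∷ u) =
    ++⁺ (++⁻ˡ xs x∉) (All.head (++⁻ʳ xs x∉) ∷ []) ∷ Unique-prefix xs u

back-edge⇒HasCycle : ∀ {m} {E : Fin m → Fin m → Set} {x y w rest} →
                     Linked E (x ∷ y ∷ rest) → Unique (x ∷ y ∷ rest) → w ∈ₗ rest → E w x → HasCycle E
back-edge⇒HasCycle {x = x} {y} {w} L U w∈rest Ewx with ∈-∃++ w∈rest
... | ys , zs , refl =
  x , w , y ∷ ys , s≤s z≤n , Linked-prefix (x ∷ y ∷ ys) L , Unique-prefix (x ∷ y ∷ ys) U , Ewx

IsLeaf : ∀ {m} → (Fin m → Fin m → Set) → Fin m → Fin m → Set
IsLeaf E ℓ p = E ℓ p × (∀ {q} → E ℓ q → q ≡ p)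

module _ {m} {E : Fin m → Fin m → Set} (E? : ∀ i j → Dec (E i j))
         (E-sym : ∀ {i j} → E i j → E j i) (E-irrefl : ∀ {i j} → E i j → i ≢ j)
         (acyclic : ¬ HasCycle E) where

  open import Data.List.Membership.DecPropositional (_≟_ {m}) using () renaming (_∈?_ to _∈ₗ?_)

  -- Walk away from z until e has no other neighbour: by acyclicity a new neighbour is never
  -- on the path, and a path has at most m vertices.
  private
    grow : ∀ fuel {e z rest} → Linked E (e ∷ z ∷ rest) → Unique (e ∷ z ∷ rest) →
           m < fuel + length (e ∷ z ∷ rest) → ∃₂ (IsLeaf E)
    grow zero        L U m<len = contradiction (Unique⇒length≤ U) (<⇒≱ m<len)
    grow (suc fuel) {e} {z} {rest} L U m<len with any? (λ w → E? e w ×-dec ¬? (w ≟ z))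
    ... | no ¬branch =
      e , z , Linked.head L , λ {q} Eeq → decidable-stable (q ≟ z) (λ q≢z → ¬branch (q , Eeq , q≢z))
    ... | yes (w , Eew , w≢z) with w ∈ₗ? (e ∷ z ∷ rest)
    ... | yes (here w≡e)             = contradiction (sym w≡e) (E-irrefl Eew)
    ... | yes (there (here w≡z))     = contradiction w≡z w≢z
    ... | yes (there (there w∈rest)) = contradiction (back-edge⇒HasCycle L U w∈rest (E-sym Eew)) acyclic
    ... | no  w∉path =
      grow fuel (E-sym Eew ∷ L) (¬Any⇒All¬ _ w∉path ∷ U) (subst (m <_) (sym (+-suc fuel _)) m<len)

  edge⇒∃leaf : ∀ {i j} → E i j → ∃₂ (IsLeaf E)
  edge⇒∃leaf Eij =
    grow m (E-sym Eij ∷ [-]) ((E-irrefl (E-sym Eij) ∷ []) ∷ [] ∷ []) (m<m+n m (s≤s z≤n))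

_-ᴱ_ : ∀ {m} → (Fin m → Fin m → Set) → Fin m → Fin m → Fin m → Set
(E -ᴱ ℓ) a b = E a b × a ≢ ℓ × b ≢ ℓ

-ᴱ-dec : ∀ {m} {E : Fin m → Fin m → Set} → (∀ i j → Dec (E i j)) → ∀ ℓ i j → Dec ((E -ᴱ ℓ) i j)
-ᴱ-dec E? ℓ i j = E? i j ×-dec ¬? (i ≟ ℓ) ×-dec ¬? (j ≟ ℓ)

ConnectedOnFaces : ∀ {n m} → (Fin m → Subset n) → Subset m → (Fin m → Fin m → Set) → Set
ConnectedOnFaces F S E = ∀ v {i j} → i ∈ S → j ∈ S → v ∈ F i → v ∈ F j →
  ∃ λ xs → IsPath E i j xs × All (λ u → v ∈ F u) xs

degree : ∀ {n m} → (Fin m → Subset n) → Subset m → Fin n → ℕ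
degree F S v = ∑[ i ∈ S ] χ (F i) v

excess : ∀ {n m} → (Fin m → Subset n) → Subset m → ℕ
excess {n} F S = ∑[ v < n ] (degree F S v ∸ 1)

degree-≥1 : ∀ {n m} {F : Fin m → Subset n} {S : Subset m} {i v} → i ∈ S → v ∈ F i → 1 ≤ degree F S v
degree-≥1 {F = F} {v = v} i∈S v∈Fi = subst (_≤ _) (χ-∈ v∈Fi) (∑∈-≥ (λ j → χ (F j) v) i∈S)

degree≤∣S∣ : ∀ {n m} (F : Fin m → Subset n) (S : Subset m) v → degree F S v ≤ ∣ S ∣
degree≤∣S∣ F S v = subst (degree F S v ≤_) (trans (∑∈-const S 1) (*-identityˡ ∣ S ∣))
  (∑-mono-≤ (λ i → *-monoʳ-≤ (χ S i) (χ≤1 (F i) v)))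

∑-degree : ∀ {n m} (F : Fin m → Subset n) (S : Subset m) → ∑[ v < n ] degree F S v ≡ ∑[ i ∈ S ] ∣ F i ∣
∑-degree {n} {m} F S = begin
  ∑[ v < n ] ∑[ i < m ] (χ S i * χ (F i) v)   ≡⟨ ∑-comm (λ v i → χ S i * χ (F i) v) ⟩
  ∑[ i < m ] ∑[ v < n ] (χ S i * χ (F i) v)   ≡⟨ sum-cong-≗ (λ i → ∑-*ˡ (χ S i) (χ (F i))) ⟩
  ∑[ i < m ] (χ S i * ∑[ v < n ] χ (F i) v)   ≡⟨ sum-cong-≗ (λ i → cong (χ S i *_) (∣p∣≡∑χ (F i))) ⟨
  ∑[ i ∈ S ] ∣ F i ∣                          ∎
  where open ≡-Reasoning

excess-singleton : ∀ {n m} (F : Fin m → Subset n) (S : Subset m) → ∣ S ∣ ≡ 1 → excess F S ≡ 0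
excess-singleton {n} F S ∣S∣≡1 = trans (sum-cong-≗ degree∸1≡0) (trans (∑-const n 0) (*-zeroʳ n))
  where
  degree∸1≡0 : ∀ v → degree F S v ∸ 1 ≡ 0
  degree∸1≡0 v = m≤n⇒m∸n≡0 (subst (degree F S v ≤_) ∣S∣≡1 (degree≤∣S∣ F S v))

first-edge : ∀ {m} {E : Fin m → Fin m → Set} {i j xs} → IsPath E i j xs → i ≢ j → ∃ (E i)
first-edge {xs = _ ∷ []}    (_       , _ , refl , refl) i≢j = contradiction refl i≢j
first-edge {xs = _ ∷ y ∷ _} (Eiy ∷ _ , _ , refl , _)    _   = y , Eiy

module _ {n m} {F : Triangles n m} {S : Subset m} {E : Fin m → Fin m → Set}
         (T : IsTreeInDual F S E) where

  open IsTreeInDual T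

  tree-edge : 2 ≤ ∣ S ∣ → ∃₂ E
  tree-edge 2≤∣S∣ with nonempty
  ... | i , i∈S with 1≤∣p∣⇒Nonempty (S - i) (s≤s⁻¹ (subst (2 ≤_) (∣p∣≡1+∣p-x∣ i∈S) 2≤∣S∣))
  ... | j , j∈S-i with x∈p-y⇒x∈p×x≢y {p = S} j∈S-i
  ... | j∈S , j≢i with conn i j i∈S j∈S
  ... | _ , path = i , first-edge path (j≢i ∘ sym)

  tree-leaf : (∀ i j → Dec (E i j)) → 2 ≤ ∣ S ∣ → ∃₂ (IsLeaf E)
  tree-leaf E? 2≤∣S∣ = edge⇒∃leaf E? (edgeSym _ _) (proj₁ ∘ edgeInEG _ _) acyclic (proj₂ (proj₂ (tree-edge 2≤∣S∣)))

  module _ {ℓ p} (leaf : IsLeaf E ℓ p) where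

    private
      Eℓp = proj₁ leaf
      only-p = proj₂ leaf

      ∈S-ℓ⁻ : ∀ {i} → i ∈ S - ℓ → i ∈ S × i ≢ ℓ
      ∈S-ℓ⁻ = x∈p-y⇒x∈p×x≢y {p = S}

    ℓ∈S : ℓ ∈ S
    ℓ∈S = proj₁ (edgeVerts ℓ p Eℓp)

    p∈S-ℓ : p ∈ S - ℓ
    p∈S-ℓ = x∈p∧x≢y⇒x∈p-y (proj₂ (edgeVerts ℓ p Eℓp)) (proj₁ (edgeInEG ℓ p Eℓp) ∘ sym)

    -- An interior ℓ would have both of its path neighbours equal to p.
    leaf-avoiding : ∀ x ys {j} → Linked E (x ∷ ys) → Unique (x ∷ ys) → last (x ∷ ys) ≡ just j →
                    x ≢ ℓ → j ≢ ℓ → All (_≢ ℓ) (x ∷ ys)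
    leaf-avoiding x []       _          _ _ x≢ℓ _ = x≢ℓ ∷ []
    leaf-avoiding x (y ∷ ys) (Exy ∷ L) (_ ∷ U) last≡ x≢ℓ j≢ℓ with y ≟ ℓ
    leaf-avoiding x (y ∷ [])     (Exy ∷ L)         (_ ∷ U)            refl  x≢ℓ j≢ℓ | yes refl = contradiction refl j≢ℓ
    leaf-avoiding x (y ∷ z ∷ ws) (Exy ∷ Eyz ∷ L)   ((_ ∷ x≢z ∷ _) ∷ U) _     x≢ℓ j≢ℓ | yes refl =
      contradiction (trans (only-p (edgeSym x y Exy)) (sym (only-p Eyz))) x≢z
    ... | no y≢ℓ = x≢ℓ ∷ leaf-avoiding y ys L U last≡ y≢ℓ j≢ℓ

    path-avoiding-leaf : ∀ {i j xs} → IsPath E i j xs → i ≢ ℓ → j ≢ ℓ → IsPath (E -ᴱ ℓ) i j xs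
    path-avoiding-leaf {xs = x ∷ ys} (L , U , refl , last≡) i≢ℓ j≢ℓ =
      Linked-restrict L (leaf-avoiding x ys L U last≡ i≢ℓ j≢ℓ) , U , refl , last≡

    remove-leaf : IsTreeInDual F (S - ℓ) (E -ᴱ ℓ)
    remove-leaf = record
      { edgeInEG  = λ i j (Eij , _) → edgeInEG i j Eij
      ; edgeSym   = λ i j (Eij , i≢ℓ , j≢ℓ) → edgeSym i j Eij , j≢ℓ , i≢ℓ
      ; edgeVerts = λ i j (Eij , i≢ℓ , j≢ℓ) →
          x∈p∧x≢y⇒x∈p-y (proj₁ (edgeVerts i j Eij)) i≢ℓ , x∈p∧x≢y⇒x∈p-y (proj₂ (edgeVerts i j Eij)) j≢ℓ
      ; nonempty  = p , p∈S-ℓ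
      ; conn      = λ i j i∈ j∈ →
          let i∈S , i≢ℓ = ∈S-ℓ⁻ i∈
              j∈S , j≢ℓ = ∈S-ℓ⁻ j∈
              xs , path = conn i j i∈S j∈S
          in xs , path-avoiding-leaf path i≢ℓ j≢ℓ
      ; acyclic   = λ (x , y , xs , len , L , U , Eyx) →
          acyclic (x , y , xs , len , Linked.map proj₁ L , U , proj₁ Eyx)
      }

    module _ (faces : ConnectedOnFaces F S E) where

      remove-leaf-faces : ConnectedOnFaces F (S - ℓ) (E -ᴱ ℓ)
      remove-leaf-faces v i∈ j∈ v∈Fi v∈Fj =
        let i∈S , i≢ℓ = ∈S-ℓ⁻ i∈
            j∈S , j≢ℓ = ∈S-ℓ⁻ j∈
            xs , path , on-face = faces v i∈S j∈S v∈Fi v∈Fj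
        in xs , path-avoiding-leaf path i≢ℓ j≢ℓ , on-face

      -- A path from ℓ to u inside the face of v must leave ℓ through p, which is not on that face.
      private-vertex-unshared : ∀ {v u} → v ∈ F ℓ → v ∉ F p → u ∈ S - ℓ → v ∉ F u
      private-vertex-unshared {v} {u} v∈Fℓ v∉Fp u∈ v∈Fu with faces v ℓ∈S (proj₁ (∈S-ℓ⁻ u∈)) v∈Fℓ v∈Fu
      ... | _ ∷ []    , (_ , _ , refl , refl) , _           = proj₂ (∈S-ℓ⁻ u∈) refl
      ... | _ ∷ y ∷ _ , (Eℓy ∷ _ , _ , refl , _) , _ ∷ v∈Fy ∷ _ = v∉Fp (subst (λ q → v ∈ F q) (only-p Eℓy) v∈Fy)

      degree∸1-remove-leaf : ∀ v → degree F S v ∸ 1 ≡ (degree F (S - ℓ) v ∸ 1) + χ (F ℓ) v * χ (F p) v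
      degree∸1-remove-leaf v rewrite ∑∈-remove (λ i → χ (F i) v) ℓ∈S with v ∈? F ℓ | v ∈? F p
      ... | no v∉Fℓ | _ rewrite χ-∉ v∉Fℓ = sym (+-identityʳ _)
      ... | yes v∈Fℓ | yes v∈Fp rewrite χ-∈ v∈Fℓ | χ-∈ v∈Fp = sym (m∸n+n≡m (degree-≥1 {F = F} p∈S-ℓ v∈Fp))
      ... | yes v∈Fℓ | no v∉Fp rewrite χ-∈ v∈Fℓ | χ-∉ v∉Fp
                                   | ∑∈-zero (S - ℓ) (λ i → χ (F i) v) (χ-∉ ∘ private-vertex-unshared v∈Fℓ v∉Fp) = refl

      excess-remove-leaf : excess F S ≡ excess F (S - ℓ) + 2
      excess-remove-leaf = begin
        excess F S                              ≡⟨ sum-cong-≗ degree∸1-remove-leaf ⟩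
        ∑[ v < n ] (d′ v + shared v)            ≡⟨ ∑-distrib-+ d′ shared ⟩
        excess F (S - ℓ) + ∑[ v < n ] shared v  ≡⟨ cong (excess F (S - ℓ) +_) (∣p∩q∣≡∑χχ (F ℓ) (F p)) ⟨
        excess F (S - ℓ) + ∣ F ℓ ∩ F p ∣        ≡⟨ cong (excess F (S - ℓ) +_) (proj₂ (edgeInEG ℓ p Eℓp)) ⟩
        excess F (S - ℓ) + 2                    ∎
        where
        open ≡-Reasoning
        d′ shared : Fin n → ℕ
        d′ v = degree F (S - ℓ) v ∸ 1
        shared v = χ (F ℓ) v * χ (F p) v

excess+2≡2*∣S∣ : ∀ {n m} {F : Triangles n m} {S : Subset m} {E : Fin m → Fin m → Set} →
                 IsTreeInDual F S E → (∀ i j → Dec (E i j)) → ConnectedOnFaces F S E →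
                 excess F S + 2 ≡ 2 * ∣ S ∣
excess+2≡2*∣S∣ {F = F} T E? faces with IsTreeInDual.nonempty T
... | i , i∈S = go _ (∣p∣≡1+∣p-x∣ i∈S) T E? faces
  where
  go : ∀ k {S : Subset _} {E} → ∣ S ∣ ≡ suc k → IsTreeInDual F S E → (∀ i j → Dec (E i j)) →
       ConnectedOnFaces F S E → excess F S + 2 ≡ 2 * ∣ S ∣
  go zero    {S} ∣S∣≡1 _ _ _ rewrite excess-singleton F S ∣S∣≡1 | ∣S∣≡1 = refl
  go (suc k) {S} {E} ∣S∣≡2+k T E? faces with tree-leaf T E? (subst (2 ≤_) (sym ∣S∣≡2+k) (s≤s (s≤s z≤n)))
  ... | ℓ , p , leaf = begin
    excess F S + 2               ≡⟨ cong (_+ 2) (excess-remove-leaf T leaf faces) ⟩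
    excess F (S - ℓ) + 2 + 2     ≡⟨ cong (_+ 2) (go k (suc-injective (trans (sym ∣S∣≡1+∣S-ℓ∣) ∣S∣≡2+k))
                                      (remove-leaf T leaf) (-ᴱ-dec E? ℓ) (remove-leaf-faces T leaf faces)) ⟩
    2 * ∣ S - ℓ ∣ + 2            ≡⟨ +-comm (2 * ∣ S - ℓ ∣) 2 ⟩
    2 + 2 * ∣ S - ℓ ∣            ≡⟨ *-suc 2 ∣ S - ℓ ∣ ⟨
    2 * suc ∣ S - ℓ ∣            ≡⟨ cong (2 *_) ∣S∣≡1+∣S-ℓ∣ ⟨
    2 * ∣ S ∣                    ∎
    where
    open ≡-Reasoning
    ∣S∣≡1+∣S-ℓ∣ : ∣ S ∣ ≡ suc ∣ S - ℓ ∣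
    ∣S∣≡1+∣S-ℓ∣ = ∣p∣≡1+∣p-x∣ (ℓ∈S T leaf)

¬¬-pull-Fin : ∀ {k} {P : Fin k → Set} → (∀ i → ¬ ¬ P i) → ¬ ¬ (∀ i → P i)
¬¬-pull-Fin {zero}  _   ¬∀P = ¬∀P (λ ())
¬¬-pull-Fin {suc k} ¬¬P ¬∀P = ¬¬P zero λ P0 →
  ¬¬-pull-Fin (¬¬P ∘ suc) λ ∀P → ¬∀P λ { zero → P0 ; (suc i) → ∀P i }

¬¬-decidable : ∀ {m} (E : Fin m → Fin m → Set) → ¬ ¬ (∀ i j → Dec (E i j))
¬¬-decidable E = ¬¬-pull-Fin λ i → ¬¬-pull-Fin λ j → ¬¬-excluded-middle

size-from-counts : ∀ {a c n} → a + n ≡ 3 * c → a + 2 ≡ 2 * c → c ≡ n ∸ 2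
size-from-counts {a} {c} {n} a+n≡3c a+2≡2c = trans (sym (m+n∸n≡m c 2)) (cong (_∸ 2) (sym n≡c+2))
  where
  open ≡-Reasoning
  n≡c+2 : n ≡ c + 2
  n≡c+2 = +-cancelˡ-≡ a n (c + 2) (begin
    a + n         ≡⟨ a+n≡3c ⟩
    c + 2 * c     ≡⟨ cong (c +_) a+2≡2c ⟨
    c + (a + 2)   ≡⟨ +-assoc c a 2 ⟨
    c + a + 2     ≡⟨ cong (_+ 2) (+-comm c a) ⟩
    a + c + 2     ≡⟨ +-assoc a c 2 ⟩
    a + (c + 2)   ∎)

lemma10 : (n m : ℕ) (tri : Triangles n m) → IsTriangulatedPolyhedralMap tri →
    (S : Subset m) (E : Fin m → Fin m → Set) → IsTreeInDual tri S E →
    (∀ (v : Fin n) (u₁ u₂ : Fin m) → u₁ ∈ S → u₂ ∈ S → OnFace tri v u₁ → OnFace tri v u₂ →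
      ∃ λ (xs : List (Fin m)) → IsPath (DualAdj tri) u₁ u₂ xs × All (OnFace tri v) xs
        × All (λ i → i ∈ S) xs × Linked E xs) →
    (∀ (v : Fin n) (xs : List (Fin m)) → Linked E xs → Unique xs → All (λ i → i ∈ S) xs →
      All (OnFace tri v) xs → pathLength xs ≤ faceLength tri v ∸ 2) →
    (∀ (v : Fin n) → ∃ λ (u : Fin m) → u ∈ S × OnFace tri v u) →
    ∣ S ∣ ≡ n ∸ 2
-- E is an arbitrary relation, but the goal is a decidable equation, so E may be assumed decidable.
lemma10 n m tri K S E T subtree-faces _ touches =
  decidable-stable (∣ S ∣ ℕ.≟ n ∸ 2) (¬¬-map size (¬¬-decidable E))
  where
  faces : ConnectedOnFaces tri S E
  faces v {i} {j} i∈S j∈S v∈i v∈j with subtree-faces v i j i∈S j∈S v∈i v∈j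
  ... | xs , (_ , U , hd , lst) , on-face , _ , L = xs , (L , U , hd , lst) , on-face

  ∑degree≡excess+n : ∑[ v < n ] degree tri S v ≡ excess tri S + n
  ∑degree≡excess+n = ∑-pred (degree tri S) λ v →
    let u , u∈S , v∈u = touches v in degree-≥1 {F = tri} u∈S v∈u

  ∑degree≡3∣S∣ : ∑[ v < n ] degree tri S v ≡ 3 * ∣ S ∣
  ∑degree≡3∣S∣ = trans (∑-degree tri S)
    (trans (sum-cong-≗ λ i → cong (χ S i *_) (IsTriangulatedPolyhedralMap.triangle K i)) (∑∈-const S 3))

  size : (∀ i j → Dec (E i j)) → ∣ S ∣ ≡ n ∸ 2
  size E? = size-from-counts (trans (sym ∑degree≡excess+n) ∑degree≡3∣S∣) (excess+2≡2*∣S∣ T E? faces)
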